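{- There exist four pp-interpretations $I_1,I_2,I_3,I_4$ of dimension $1$ of $(\mathbb{Q};<)$ in $\mathcal{RA}$, and a pp-interpretation $J$ of dimension $4$ of $\mathcal{RA}$ in $(\mathbb{Q};<)$, such that $J\circ(I_1,I_2,I_3,I_4)$ is pp-homotopic to the identity interpretation of $\mathcal{RA}$.
   Context: $\mathbb{I}$ is the set of closed rational intervals $[a,b]$ with $a<b$; write $X^-=a$, $X^+=b$. The 13 basic interval relations are: $X\,\mathsf{p}\,Y$ iff $X^+<Y^-$; $X\,\mathsf{m}\,Y$ iff $X^+=Y^-$; $X\,\mathsf{o}\,Y$ iff $X^-<Y^-<X^+<Y^+$; $X\,\mathsf{d}\,Y$ iff $X^->Y^-\wedge X^+<Y^+$; $X\,\mathsf{s}\,Y$ iff $X^-=Y^-\wedge X^+<Y^+$; $X\,\mathsf{f}\,Y$ iff $X^+=Y^+\wedge X^->Y^-$; their converses $\mathsf{r}^{\smile}=\{(X,Y):Y\,\mathsf{r}\,X\}$; and equality $\equiv$. $\mathcal{RA}$ (the rectangle algebra) is the structure with domain $\mathbb{I}^2$ whose relations are the 169 binary relations $B_{(\mathsf{r}_1,\mathsf{r}_2)}=\{(X,Y):X[1]\,\mathsf{r}_1\,Y[1]\text{ and }X[2]\,\mathsf{r}_2\,Y[2]\}$ for basic interval relations $\mathsf{r}_1,\mathsf{r}_2$. A primitive positive (pp) formula uses only atomic formulas (relations and equality), conjunction and existential quantification; definability is parameter-free. A pp-interpretation of $\mathcal{B}$ in $\mathcal{A}$ is a triple $(k,\delta,g)$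 with $\delta\subseteq A^k$ pp-definable in $\mathcal{A}$, $g:\delta\to B$ surjective, such that for every $s$-ary relation $S$ of $\mathcal{B}$ and for equality on $B$, $\{(\bar a_1,\ldots,\bar a_s)\in\delta^s:(g(\bar a_1),\ldots,g(\bar a_s))\in S\}$ is pp-definable in $\mathcal{A}$. For $I_\ell=(i,\delta_\ell,g_\ell)$ interpreting $\mathcal{D}$ in $\mathcal{C}$ and $J=(j,\epsilon,h)$ interpreting $\mathcal{C}$ in $\mathcal{D}$, $J\circ(I_1,\ldots,I_j)$ is the partial map $F:C^{ij}\rightharpoonup C$, $F(x_1,\ldots,x_{ij})=h(g_1(x_1,\ldots,x_i),\ldots,g_j(x_{ij-i+1},\ldots,x_{ij}))$, defined when each block lies in $\delta_\ell$ and the image tuple lies in $\epsilon$; it is pp-homotopic to the identity interpretation $(1,C,\mathrm{id})$ of $\mathcal{C}$ if $\{(y,x_1,\ldots,x_{ij}):F(x_1,\ldots,x_{ij})=y\}$ is pp-definable in $\mathcal{C}$. -}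

module Defs where

open import Level using (0ℓ)
open import Data.Nat using (ℕ; suc; _*_)
open import Data.Fin using (Fin; zero; suc; combine)
open import Data.Product using (Σ; ∃; _×_; _,_; proj₁; proj₂)
open import Data.Rational using (ℚ; _<_)
open import Relation.Binary.PropositionalEquality using (_≡_)
open import Function.Bundles using (_⇔_)

record Structure : Set₁ where
  field
    Carrier : Set
    Sym     : Set
    arity   : Sym → ℕ
    interp  : (r : Sym) → (Fin (arity r) → Carrier) → Set

open Structure public

data PP (𝔄 : Structure) : ℕ → Set where
  rel : ∀ {n} (r : Sym 𝔄) → (Fin (arity 𝔄 r) → Fin n) → PP 𝔄 n
  eq  : ∀ {n} → Fin n → Fin n → PP 𝔄 n
  _∧_ : ∀ {n} → PP 𝔄 n → PP 𝔄 n → PP 𝔄 n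
  ∃'  : ∀ {n} → PP 𝔄 (suc n) → PP 𝔄 n

cons : {A : Set} {n : ℕ} → A → (Fin n → A) → Fin (suc n) → A
cons a v zero    = a
cons a v (suc i) = v i

⟦_⟧ : {𝔄 : Structure} {n : ℕ} → PP 𝔄 n → (Fin n → Carrier 𝔄) → Set
⟦_⟧ {𝔄} (rel r args) v = interp 𝔄 r (λ i → v (args i))
⟦ eq i j ⟧ v = v i ≡ v j
⟦ φ ∧ ψ ⟧ v = ⟦ φ ⟧ v × ⟦ ψ ⟧ v
⟦ ∃' φ ⟧ v = ∃ λ a → ⟦ φ ⟧ (cons a v)

PPDefinable : (𝔄 : Structure) (n : ℕ) → ((Fin n → Carrier 𝔄) → Set) → Set
PPDefinable 𝔄 n S = Σ (PP 𝔄 n) λ φ → ∀ v → S v ⇔ ⟦ φ ⟧ v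

block : {A : Set} {s k : ℕ} → (Fin (s * k) → A) → Fin s → Fin k → A
block {s = s} {k} v i j = v (combine i j)

-- pp-interpretations (k, δ, g) of 𝔅 in 𝔄.
-- g is a partial map A^k ⇀ B with domain δ: it takes an *irrelevant*
-- proof of membership in δ, so its value depends only on the tuple.

record Interp (𝔄 𝔅 : Structure) (k : ℕ) : Set₁ where
  field
    δ     : (Fin k → Carrier 𝔄) → Set
    δ-pp  : PPDefinable 𝔄 k δ
    g     : (x : Fin k → Carrier 𝔄) → .(δ x) → Carrier 𝔅
    surj  : ∀ b → Σ (Fin k → Carrier 𝔄) λ x → Σ (δ x) λ p → g x p ≡ b
    rel-pp : (r : Sym 𝔅) → PPDefinable 𝔄 (arity 𝔅 r * k) λ v →
               Σ (∀ i → δ (block {s = arity 𝔅 r} v i)) λ ps →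
                 interp 𝔅 r (λ i → g (block {s = arity 𝔅 r} v i) (ps i))
    eq-pp : PPDefinable 𝔄 (2 * k) λ v →
              Σ (∀ i → δ (block {s = 2} v i)) λ ps →
                g (block {s = 2} v zero) (ps zero)
                  ≡ g (block {s = 2} v (suc zero)) (ps (suc zero))

open Interp public

-- J ∘ (I₁,…,I_j) is pp-homotopic to the identity interpretation of ℭ:
-- the graph {(y, x₁,…,x_{ij}) : F(x₁,…,x_{ij}) = y} is pp-definable in ℭ.
PPHomotopicToId : {ℭ 𝔇 : Structure} {i j : ℕ} →
                  (Fin j → Interp ℭ 𝔇 i) → Interp 𝔇 ℭ j → Set
PPHomotopicToId {ℭ} {𝔇} {i} {j} I J =
  PPDefinable ℭ (suc (j * i)) λ v →
    let y = v zero
        x = λ m → v (suc m)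
    in Σ (∀ ℓ → δ (I ℓ) (block {s = j} x ℓ)) λ ps →
       Σ (δ J (λ ℓ → g (I ℓ) (block {s = j} x ℓ) (ps ℓ))) λ q →
         g J (λ ℓ → g (I ℓ) (block {s = j} x ℓ) (ps ℓ)) q ≡ y

QLt : Structure
QLt = record
  { Carrier = ℚ
  ; Sym     = Data.Unit.⊤
  ; arity   = λ _ → 2
  ; interp  = λ _ v → v zero < v (suc zero)
  }
  where import Data.Unit

record Interval : Set where
  constructor [_,_]⟨_⟩
  field
    lo  : ℚ
    hi  : ℚ
    .lo<hi : lo < hi

open Interval public

data BasicRel : Set where
  p m o d s f     : BasicRel
  p˘ m˘ o˘ d˘ s˘ f˘ : BasicRel
  ≡r              : BasicRel

holds : BasicRel → Interval → Interval → Set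
holds p X Y = hi X < lo Y
holds m X Y = hi X ≡ lo Y
holds o X Y = lo X < lo Y × lo Y < hi X × hi X < hi Y
holds d X Y = lo X > lo Y × hi X < hi Y
  where open Data.Rational using (_>_)
holds s X Y = lo X ≡ lo Y × hi X < hi Y
holds f X Y = hi X ≡ hi Y × lo X > lo Y
  where open Data.Rational using (_>_)
holds p˘ X Y = holds p Y X
holds m˘ X Y = holds m Y X
holds o˘ X Y = holds o Y X
holds d˘ X Y = holds d Y X
holds s˘ X Y = holds s Y X
holds f˘ X Y = holds f Y X
holds ≡r X Y = X ≡ Y

RA : Structure
RA = record
  { Carrier = Interval × Interval
  ; Sym     = BasicRel × BasicRel
  ; arity   = λ _ → 2
  ; interp  = λ r v → holds (proj₁ r) (proj₁ (v zero)) (proj₁ (v (suc zero)))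
                    × holds (proj₂ r) (proj₂ (v zero)) (proj₂ (v (suc zero)))
  }

-- A rectangle is a quadruple of rationals a < b, c < e read as ([a,b],[c,e]); under
-- this reading every relation B_(r₁,r₂) is a conjunction of (in)equalities between
-- endpoints, which gives J. Conversely, each I_ℓ sends a rectangle to the left
-- endpoint of one of its projections. In the interval algebra, "X⁻ < Y⁻", "X⁻ = Y⁻"
-- and "X⁺ = Y⁻" each say that one interval Z stands in fixed basic relations to X
-- and to Y; inside 𝓡𝓐 the other projection of the witness rectangle is
-- unconstrained and can be put to the right of everything. Hence the composite map
-- F(x₁,…,x₄) = ([x₁[1]⁻, x₂[1]⁻], [x₃[2]⁻, x₄[2]⁻]) has a pp-definable graph:
-- y = F(x) iff y[1]⁻ = x₁[1]⁻, y[1]⁺ = x₂[1]⁻, y[2]⁻ = x₃[2]⁻ and y[2]⁺ = x₄[2]⁻.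
module Submission where

open import Defs
open import Data.Nat using (ℕ)
open import Data.Fin using (Fin; zero; suc; #_; combine)
open import Data.Fin.Properties using (∀-cons)
open import Data.Product using (Σ; ∃; _×_; _,_; proj₁; proj₂)
open import Data.Product.Function.NonDependent.Propositional using (_×-⇔_)
open import Data.Product.Properties using (×-≡,≡→≡; ×-≡,≡←≡)
open import Data.Rational using (ℚ; _<_; _+_; _⊓_; _⊔_; 1ℚ; _<?_)
open import Data.Rational.Properties
  using (<-trans; <-dense; ≤-<-trans; <-≤-trans; +-identityʳ; +-monoʳ-<; positive⁻¹;
         ⊓-sel; p⊓q≤p; p⊓q≤q; p≤p⊔q; p≤q⊔p)
open import Data.Sum using ([_,_]′)
open import Data.Unit using (⊤; tt)
open import Data.Vec.Functional using ([]; _∷_)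
open import Function.Bundles using (_⇔_; mk⇔; Equivalence)
open import Function.Construct.Composition using (_⇔-∘_)
open import Function.Construct.Identity using (⇔-id)
open import Relation.Binary.PropositionalEquality using (_≡_; refl; sym; trans; cong; subst; subst₂)
open import Relation.Nullary.Decidable using (recompute)

open Equivalence using (to; from)

PPDefinable-resp : ∀ {𝔄 n} {S T : (Fin n → Carrier 𝔄) → Set} →
                   (∀ v → S v ⇔ T v) → PPDefinable 𝔄 n T → PPDefinable 𝔄 n S
PPDefinable-resp S⇔T (φ , T⇔φ) = φ , λ v → T⇔φ v ⇔-∘ S⇔T v

PPDefinable-× : ∀ {𝔄 n} {S T : (Fin n → Carrier 𝔄) → Set} →
                PPDefinable 𝔄 n S → PPDefinable 𝔄 n T → PPDefinable 𝔄 n (λ v → S v × T v)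
PPDefinable-× (φ , S⇔φ) (ψ , T⇔ψ) = φ ∧ ψ , λ v → S⇔φ v ×-⇔ T⇔ψ v

q<q+1 : ∀ q → q < q + 1ℚ
q<q+1 q = subst (_< q + 1ℚ) (+-identityʳ q) (+-monoʳ-< q (positive⁻¹ 1ℚ))

⊓-glb-< : ∀ {a b c} → c < a → c < b → c < a ⊓ b
⊓-glb-< {a} {b} c<a c<b =
  [ (λ e → subst (_ <_) (sym e) c<a) , (λ e → subst (_ <_) (sym e) c<b) ]′ (⊓-sel a b)

lo<hiᵣ : (X : Interval) → lo X < hi X
lo<hiᵣ [ a , b ]⟨ a<b ⟩ = recompute (a <? b) a<b

Interval-≡ : ∀ {X Y : Interval} → lo X ≡ lo Y → hi X ≡ hi Y → X ≡ Y
Interval-≡ {[ _ , _ ]⟨ _ ⟩} {[ _ , _ ]⟨ _ ⟩} refl refl = refl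

Interval-≡⇔ : ∀ {X Y : Interval} → X ≡ Y ⇔ (lo X ≡ lo Y × hi X ≡ hi Y)
Interval-≡⇔ = mk⇔ (λ X≡Y → cong lo X≡Y , cong hi X≡Y) (λ (lo≡ , hi≡) → Interval-≡ lo≡ hi≡)

unitInterval : ℚ → Interval
unitInterval q = [ q , q + 1ℚ ]⟨ q<q+1 q ⟩

common-p-successor : ∀ X Y → ∃ λ W → holds p X W × holds p Y W
common-p-successor X Y =
  unitInterval (max + 1ℚ) ,
  ≤-<-trans (p≤p⊔q (hi X) (hi Y)) (q<q+1 max) , ≤-<-trans (p≤q⊔p (hi X) (hi Y)) (q<q+1 max)
  where
  max : ℚ
  max = hi X ⊔ hi Y

Witnessed : BasicRel → BasicRel → (Interval → Interval → Set) → Set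
Witnessed r₁ r₂ P = ∀ X Y → P X Y ⇔ (∃ λ Z → holds r₁ Z X × holds r₂ Z Y)

lo<lo-witnessed : Witnessed s p (λ X Y → lo X < lo Y)
lo<lo-witnessed X Y =
  mk⇔ witness (λ (Z , (Z⁻≡X⁻ , _) , Z⁺<Y⁻) → subst (_< lo Y) Z⁻≡X⁻ (<-trans (lo<hiᵣ Z) Z⁺<Y⁻))
  where
  witness : lo X < lo Y → ∃ λ Z → holds s Z X × holds p Z Y
  witness X⁻<Y⁻ with <-dense (⊓-glb-< (lo<hiᵣ X) X⁻<Y⁻)
  ... | c , X⁻<c , c<min =
    [ lo X , c ]⟨ X⁻<c ⟩ , (refl , <-≤-trans c<min (p⊓q≤p (hi X) _)) , <-≤-trans c<min (p⊓q≤q (hi X) _)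

lo≡lo-witnessed : Witnessed s s (λ X Y → lo X ≡ lo Y)
lo≡lo-witnessed X Y = mk⇔ witness (λ (Z , (Z⁻≡X⁻ , _) , (Z⁻≡Y⁻ , _)) → trans (sym Z⁻≡X⁻) Z⁻≡Y⁻)
  where
  witness : lo X ≡ lo Y → ∃ λ Z → holds s Z X × holds s Z Y
  witness X⁻≡Y⁻ with <-dense (⊓-glb-< (lo<hiᵣ X) (subst (_< hi Y) (sym X⁻≡Y⁻) (lo<hiᵣ Y)))
  ... | c , X⁻<c , c<min =
    [ lo X , c ]⟨ X⁻<c ⟩ , (refl , <-≤-trans c<min (p⊓q≤p (hi X) _)) , (X⁻≡Y⁻ , <-≤-trans c<min (p⊓q≤q (hi X) _))

hi≡lo-witnessed : Witnessed f m (λ X Y → hi X ≡ lo Y)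
hi≡lo-witnessed X Y = mk⇔ witness (λ (Z , (Z⁺≡X⁺ , _) , Z⁺≡Y⁻) → trans (sym Z⁺≡X⁺) Z⁺≡Y⁻)
  where
  witness : hi X ≡ lo Y → ∃ λ Z → holds f Z X × holds m Z Y
  witness X⁺≡Y⁻ with <-dense (lo<hiᵣ X)
  ... | c , X⁻<c , c<X⁺ = [ c , hi X ]⟨ c<X⁺ ⟩ , (refl , X⁻<c) , X⁺≡Y⁻

data Axis : Set where
  horizontal vertical : Axis

_along_ : Interval × Interval → Axis → Interval
R along horizontal = proj₁ R
R along vertical   = proj₂ R

onAxis : Axis → BasicRel → BasicRel → Sym RA
onAxis horizontal r r′ = r , r′
onAxis vertical   r r′ = r′ , r

Witnessed⇒PPDefinable : ∀ {r₁ r₂ P} → Witnessed r₁ r₂ P → (a : Axis) {n : ℕ} (i j : Fin n) →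
                        PPDefinable RA n (λ v → P (v i along a) (v j along a))
Witnessed⇒PPDefinable {r₁} {r₂} {P} P⇔∃Z a i j =
  ∃' (rel (onAxis a r₁ p˘) (zero ∷ suc i ∷ []) ∧ rel (onAxis a r₂ p˘) (zero ∷ suc j ∷ [])) ,
  λ v → lifted a (v i) (v j)
  where
  lifted : ∀ a R S → P (R along a) (S along a) ⇔
           (∃ λ Q → interp RA (onAxis a r₁ p˘) (Q ∷ R ∷ []) × interp RA (onAxis a r₂ p˘) (Q ∷ S ∷ []))
  lifted horizontal (X , X′) (Y , Y′) = mk⇔
    (λ PXY → let (Z , ZX , ZY) = to (P⇔∃Z X Y) PXY ; (W , X′W , Y′W) = common-p-successor X′ Y′
             in (Z , W) , (ZX , X′W) , (ZY , Y′W))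
    (λ ((Z , _) , (ZX , _) , (ZY , _)) → from (P⇔∃Z X Y) (Z , ZX , ZY))
  lifted vertical (X′ , X) (Y′ , Y) = mk⇔
    (λ PXY → let (Z , ZX , ZY) = to (P⇔∃Z X Y) PXY ; (W , X′W , Y′W) = common-p-successor X′ Y′
             in (W , Z) , (X′W , ZX) , (Y′W , ZY))
    (λ ((_ , Z) , (_ , ZX) , (_ , ZY)) → from (P⇔∃Z X Y) (Z , ZX , ZY))

lo<lo-pp : (a : Axis) {n : ℕ} (i j : Fin n) → PPDefinable RA n (λ v → lo (v i along a) < lo (v j along a))
lo<lo-pp = Witnessed⇒PPDefinable {r₁ = s} {r₂ = p} lo<lo-witnessed

lo≡lo-pp : (a : Axis) {n : ℕ} (i j : Fin n) → PPDefinable RA n (λ v → lo (v i along a) ≡ lo (v j along a))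
lo≡lo-pp = Witnessed⇒PPDefinable {r₁ = s} {r₂ = s} lo≡lo-witnessed

hi≡lo-pp : (a : Axis) {n : ℕ} (i j : Fin n) → PPDefinable RA n (λ v → hi (v i along a) ≡ lo (v j along a))
hi≡lo-pp = Witnessed⇒PPDefinable {r₁ = f} {r₂ = m} hi≡lo-witnessed

diagonal-along : ∀ a (X : Interval) → (X , X) along a ≡ X
diagonal-along horizontal X = refl
diagonal-along vertical   X = refl

Σ-⊤⇔ : {A B : Set} → (Σ (A → ⊤) λ _ → B) ⇔ B
Σ-⊤⇔ = mk⇔ proj₂ (λ b → (λ _ → tt) , b)

leftEndpoint : Axis → Interp RA QLt 1
leftEndpoint a = record
  { δ      = λ _ → ⊤
  ; δ-pp   = eq zero zero , λ _ → mk⇔ (λ _ → refl) (λ _ → tt)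
  ; g      = λ x _ → lo (x zero along a)
  ; surj   = λ q → (λ _ → unitInterval q , unitInterval q) , tt , cong lo (diagonal-along a (unitInterval q))
  ; rel-pp = λ _ → PPDefinable-resp (λ _ → Σ-⊤⇔) (lo<lo-pp a (# 0) (# 1))
  ; eq-pp  = PPDefinable-resp (λ _ → Σ-⊤⇔) (lo≡lo-pp a (# 0) (# 1))
  }

infix 25 _<ᶠ_

_<ᶠ_ : ∀ {n} → Fin n → Fin n → PP QLt n
i <ᶠ j = rel tt (i ∷ j ∷ [])

endpointFormula : BasicRel → ∀ {n} → Fin n → Fin n → Fin n → Fin n → PP QLt n
endpointFormula p  a b c e = b <ᶠ c
endpointFormula m  a b c e = eq b c
endpointFormula o  a b c e = a <ᶠ c ∧ (c <ᶠ b ∧ b <ᶠ e)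
endpointFormula d  a b c e = c <ᶠ a ∧ b <ᶠ e
endpointFormula s  a b c e = eq a c ∧ b <ᶠ e
endpointFormula f  a b c e = eq b e ∧ c <ᶠ a
endpointFormula p˘ a b c e = endpointFormula p c e a b
endpointFormula m˘ a b c e = endpointFormula m c e a b
endpointFormula o˘ a b c e = endpointFormula o c e a b
endpointFormula d˘ a b c e = endpointFormula d c e a b
endpointFormula s˘ a b c e = endpointFormula s c e a b
endpointFormula f˘ a b c e = endpointFormula f c e a b
endpointFormula ≡r a b c e = eq a c ∧ eq b e

holds⇔endpointFormula : ∀ r {n} (a b c e : Fin n) (v : Fin n → ℚ) .(a<b : v a < v b) .(c<e : v c < v e) →
                        holds r [ v a , v b ]⟨ a<b ⟩ [ v c , v e ]⟨ c<e ⟩ ⇔ ⟦ endpointFormula r a b c e ⟧ v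
holds⇔endpointFormula p  a b c e v _ _ = ⇔-id _
holds⇔endpointFormula m  a b c e v _ _ = ⇔-id _
holds⇔endpointFormula o  a b c e v _ _ = ⇔-id _
holds⇔endpointFormula d  a b c e v _ _ = ⇔-id _
holds⇔endpointFormula s  a b c e v _ _ = ⇔-id _
holds⇔endpointFormula f  a b c e v _ _ = ⇔-id _
holds⇔endpointFormula p˘ a b c e v a<b c<e = holds⇔endpointFormula p c e a b v c<e a<b
holds⇔endpointFormula m˘ a b c e v a<b c<e = holds⇔endpointFormula m c e a b v c<e a<b
holds⇔endpointFormula o˘ a b c e v a<b c<e = holds⇔endpointFormula o c e a b v c<e a<b
holds⇔endpointFormula d˘ a b c e v a<b c<e = holds⇔endpointFormula d c e a b v c<e a<b
holds⇔endpointFormula s˘ a b c e v a<b c<e = holds⇔endpointFormula s c e a b v c<e a<b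
holds⇔endpointFormula f˘ a b c e v a<b c<e = holds⇔endpointFormula f c e a b v c<e a<b
holds⇔endpointFormula ≡r a b c e v _ _ = Interval-≡⇔

IsRectangle : (Fin 4 → ℚ) → Set
IsRectangle v = v (# 0) < v (# 1) × v (# 2) < v (# 3)

toRectangle : (v : Fin 4 → ℚ) → .(IsRectangle v) → Interval × Interval
toRectangle v q = [ v (# 0) , v (# 1) ]⟨ proj₁ q ⟩ , [ v (# 2) , v (# 3) ]⟨ proj₂ q ⟩

rectangleFormula : ∀ {n} → (Fin 4 → Fin n) → PP QLt n
rectangleFormula ι = ι (# 0) <ᶠ ι (# 1) ∧ ι (# 2) <ᶠ ι (# 3)

RectangleRelation : Sym RA → (Fin 8 → ℚ) → Set
RectangleRelation r v = Σ (∀ i → IsRectangle (block {s = 2} v i)) λ q →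
                          interp RA r (λ i → toRectangle (block {s = 2} v i) (q i))

coord : Fin 2 → Fin 4 → Fin 8
coord = combine

relatedFormula : Sym RA → PP QLt 8
relatedFormula (r₁ , r₂) =
  endpointFormula r₁ (coord (# 0) (# 0)) (coord (# 0) (# 1)) (coord (# 1) (# 0)) (coord (# 1) (# 1)) ∧
  endpointFormula r₂ (coord (# 0) (# 2)) (coord (# 0) (# 3)) (coord (# 1) (# 2)) (coord (# 1) (# 3))

related⇔relatedFormula : ∀ r (v : Fin 8 → ℚ) →
                         .(qX : IsRectangle (block {s = 2} v (# 0))) .(qY : IsRectangle (block {s = 2} v (# 1))) →
                         interp RA r (toRectangle (block {s = 2} v (# 0)) qX ∷
                                      toRectangle (block {s = 2} v (# 1)) qY ∷ []) ⇔
                         ⟦ relatedFormula r ⟧ v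
related⇔relatedFormula (r₁ , r₂) v qX qY =
  holds⇔endpointFormula r₁ (coord (# 0) (# 0)) (coord (# 0) (# 1)) (coord (# 1) (# 0)) (coord (# 1) (# 1))
                        v (proj₁ qX) (proj₁ qY) ×-⇔
  holds⇔endpointFormula r₂ (coord (# 0) (# 2)) (coord (# 0) (# 3)) (coord (# 1) (# 2)) (coord (# 1) (# 3))
                        v (proj₂ qX) (proj₂ qY)

RectangleRelation-pp : ∀ r → PPDefinable QLt 8 (RectangleRelation r)
RectangleRelation-pp r =
  (rectangleFormula (coord (# 0)) ∧ rectangleFormula (coord (# 1))) ∧ relatedFormula r ,
  λ v → mk⇔
    (λ (q , R) → (q (# 0) , q (# 1)) , to (related⇔relatedFormula r v (q (# 0)) (q (# 1))) R)
    (λ ((qX , qY) , R) → ∀-cons qX (∀-cons qY λ ()) , from (related⇔relatedFormula r v qX qY) R)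

endpoints : Interp QLt RA 4
endpoints = record
  { δ      = IsRectangle
  ; δ-pp   = rectangleFormula (λ i → i) , λ _ → ⇔-id _
  ; g      = toRectangle
  ; surj   = λ (X , Y) → (lo X ∷ hi X ∷ lo Y ∷ hi Y ∷ []) , (lo<hiᵣ X , lo<hiᵣ Y) , refl
  ; rel-pp = RectangleRelation-pp
  ; eq-pp  = PPDefinable-resp
               (λ _ → mk⇔ (λ (q , R≡S) → q , ×-≡,≡←≡ R≡S) (λ (q , R≡S) → q , ×-≡,≡→≡ R≡S))
               (RectangleRelation-pp (≡r , ≡r))
  }

toRectangle-graph : ∀ w (R : Interval × Interval) →
                    (Σ (IsRectangle w) λ q → toRectangle w q ≡ R) ⇔
                    ((lo (proj₁ R) ≡ w (# 0) × hi (proj₁ R) ≡ w (# 1)) ×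
                     (lo (proj₂ R) ≡ w (# 2) × hi (proj₂ R) ≡ w (# 3)))
toRectangle-graph w (X , Y) = mk⇔
  (λ { (_ , refl) → (refl , refl) , (refl , refl) })
  (λ ((X⁻≡ , X⁺≡) , (Y⁻≡ , Y⁺≡)) →
     (subst₂ _<_ X⁻≡ X⁺≡ (lo<hiᵣ X) , subst₂ _<_ Y⁻≡ Y⁺≡ (lo<hiᵣ Y)) ,
     ×-≡,≡→≡ (Interval-≡ (sym X⁻≡) (sym X⁺≡) , Interval-≡ (sym Y⁻≡) (sym Y⁺≡)))

axisOf : Fin 4 → Axis
axisOf zero          = horizontal
axisOf (suc zero)    = horizontal
axisOf (suc (suc _)) = vertical

lemma4 : Σ (Fin 4 → Interp RA QLt 1) λ I → Σ (Interp QLt RA 4) λ J → PPHomotopicToId I J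
lemma4 = (λ ℓ → leftEndpoint (axisOf ℓ)) , endpoints ,
  PPDefinable-resp (λ v → toRectangle-graph (leftEndpointsOf v) (v zero) ⇔-∘ Σ-⊤⇔)
    (PPDefinable-× (PPDefinable-× (lo≡lo-pp horizontal (# 0) (# 1)) (hi≡lo-pp horizontal (# 0) (# 2)))
                   (PPDefinable-× (lo≡lo-pp vertical   (# 0) (# 3)) (hi≡lo-pp vertical   (# 0) (# 4))))
  where
  leftEndpointsOf : (Fin 5 → Interval × Interval) → Fin 4 → ℚ
  leftEndpointsOf v ℓ = lo (block {s = 4} {k = 1} (λ i → v (suc i)) ℓ zero along axisOf ℓ)
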